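{- Let $P$ and $Q$ be non-negative integers with $P$ even, with binary expansions $P=a_{n+1}a_n\cdots a_1$ and $Q=b_{n+1}b_n\cdots b_1$ ($a_1,b_1$ the least significant bits). If there exists $i$ with $1\le i\le n$ such that $a_{i+1}=b_i=1$, then there is no pair $(X,Y)$ of non-negative integers with $\mathrm{CVT}(X,Y)=P$ and $\mathrm{XOR}(X,Y)=Q$; in particular $(P,Q)$ is a leaf node of the CVT-XOR Tree with root $(0,P+Q)$.
   Context: For non-negative integers $X,Y$ written in binary, $\mathrm{XOR}(X,Y)$ is their bitwise exclusive or, and $\mathrm{CVT}(X,Y)=2\cdot(X \mathbin{\mathrm{AND}} Y)$ (bitwise AND shifted one position left, so bit $i+1$ of $\mathrm{CVT}(X,Y)$ is the AND of bit $i$ of $X$ and bit $i$ of $Y$, and bit $1$ is $0$). Define $f(X,Y)=(\mathrm{CVT}(X,Y),\mathrm{XOR}(X,Y))$, which preserves $X+Y$. The CVT-XOR Tree with root $(0,N)$ has as nodes the pairs $(X,Y)$ of non-negative integers with $X+Y=N$, the parent of a non-root node $(X,Y)$ being $f(X,Y)$; a leaf node is a node which is $f(X,Y)$ for no pair $(X,Y)$. -}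

module Defs where

open import Data.Nat using (ℕ; zero; suc; _+_; _*_; _^_; _/_; _%_)
open import Data.Product using (_×_; ∃-syntax)
open import Relation.Binary.PropositionalEquality using (_≡_)
open import Relation.Nullary using (¬_)

-- bit i of x (bit 0 = least significant), i.e. ⌊x / 2^i⌋ mod 2
bit : ℕ → ℕ → ℕ
bit zero    x = x % 2
bit (suc i) x = bit i (x / 2)

bitwise-go : (ℕ → ℕ → ℕ) → ℕ → ℕ → ℕ → ℕ
bitwise-go f zero    x y = 0
bitwise-go f (suc k) x y = f (x % 2) (y % 2) + 2 * bitwise-go f k (x / 2) (y / 2)

-- fuel x + y is enough since x, y < 2 ^ (x + y)
bitwise : (ℕ → ℕ → ℕ) → ℕ → ℕ → ℕ
bitwise f x y = bitwise-go f (x + y) x y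

xorBit : ℕ → ℕ → ℕ
xorBit 0 0 = 0
xorBit 0 _ = 1
xorBit _ 0 = 1
xorBit _ _ = 0

andBit : ℕ → ℕ → ℕ
andBit 0 _ = 0
andBit _ 0 = 0
andBit _ _ = 1

XOR : ℕ → ℕ → ℕ
XOR = bitwise xorBit

AND : ℕ → ℕ → ℕ
AND = bitwise andBit

CVT : ℕ → ℕ → ℕ
CVT x y = 2 * AND x y

-- f(X,Y) = (CVT(X,Y), XOR(X,Y)); parent map of the CVT-XOR tree
cvtxor : ℕ → ℕ → ℕ × ℕ
cvtxor x y = CVT x y , XOR x y
  where open import Data.Product using (_,_)

-- (P,Q) is a leaf node of the CVT-XOR tree with root (0, P + Q):
-- it is a node (trivially, its coordinates sum to P + Q) and has no child,
-- i.e. it is f(X,Y) for no pair (X,Y).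
IsLeaf : ℕ → ℕ → Set
IsLeaf P Q = ¬ (∃[ X ] ∃[ Y ] (CVT X Y ≡ P × XOR X Y ≡ Q))

module Submission where

-- Idea: bit i of CVT(X,Y) = 2·AND(X,Y) is bit i-1 of AND(X,Y), i.e. the AND of
-- bit i-1 of X and of Y, while bit i-1 of XOR(X,Y) is their XOR.  No two bits
-- a, b have both a AND b = 1 and a XOR b = 1, so bit i of CVT(X,Y) and bit
-- i-1 of XOR(X,Y) are never both 1.  Hence a pair (P,Q) with a_{i+1} = b_i = 1
-- is not of the form f(X,Y), i.e. it is a leaf.

open import Defs
open import Data.Nat using (ℕ; zero; suc; _+_; _*_; _^_; _%_; _/_; _≤_; _<_; _∸_; s≤s; z≤n)
open import Data.Nat.Properties using (*-comm)
open import Data.Nat.DivMod using ([m+kn]%n≡m%n; m<n⇒m%n≡m; +-distrib-/-∣ʳ; m<n⇒m/n≡0; m*n/n≡m)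
open import Data.Nat.Divisibility using (divides-refl)
open import Data.Product using (_×_; ∃-syntax; _,_)
open import Data.Empty using (⊥)
open import Relation.Binary.PropositionalEquality using (_≡_; refl; sym; trans; cong; cong₂; subst; module ≡-Reasoning)
open import Relation.Nullary using (¬_)

digit-mod : ∀ {v} → v < 2 → ∀ r → (v + 2 * r) % 2 ≡ v
digit-mod {v} v<2 r = begin
  (v + 2 * r) % 2 ≡⟨ cong (λ t → (v + t) % 2) (*-comm 2 r) ⟩
  (v + r * 2) % 2 ≡⟨ [m+kn]%n≡m%n v r 2 ⟩
  v % 2           ≡⟨ m<n⇒m%n≡m v<2 ⟩
  v               ∎
  where open ≡-Reasoning

digit-div : ∀ {v} → v < 2 → ∀ r → (v + 2 * r) / 2 ≡ r
digit-div {v} v<2 r = begin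
  (v + 2 * r) / 2   ≡⟨ cong (λ t → (v + t) / 2) (*-comm 2 r) ⟩
  (v + r * 2) / 2   ≡⟨ +-distrib-/-∣ʳ v (divides-refl r) ⟩
  v / 2 + r * 2 / 2 ≡⟨ cong₂ _+_ (m<n⇒m/n≡0 v<2) (m*n/n≡m r 2) ⟩
  0 + r             ∎
  where open ≡-Reasoning

bit-double : ∀ j A → bit (suc j) (2 * A) ≡ bit j A
bit-double j A = cong (bit j) (digit-div {0} (s≤s z≤n) A)

bit-of-zero : ∀ j → bit j 0 ≡ 0
bit-of-zero zero    = refl
bit-of-zero (suc j) = bit-of-zero j

BitValued : (ℕ → ℕ → ℕ) → Set
BitValued f = ∀ a b → f a b < 2

-- A set bit of a bitwise result (with any fuel) is the operation applied to
-- the corresponding bits of the operands; running out of fuel only clears bits.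
bitwise-go-set-bit : ∀ f → BitValued f → ∀ j k x y →
  bit j (bitwise-go f k x y) ≡ 1 → f (bit j x) (bit j y) ≡ 1
bitwise-go-set-bit f fbit j zero x y set
  with () ← trans (sym (bit-of-zero j)) set
bitwise-go-set-bit f fbit zero (suc k) x y set =
  trans (sym (digit-mod (fbit (x % 2) (y % 2)) (bitwise-go f k (x / 2) (y / 2)))) set
bitwise-go-set-bit f fbit (suc j) (suc k) x y set =
  bitwise-go-set-bit f fbit j k (x / 2) (y / 2)
    (subst (λ z → bit j z ≡ 1)
           (digit-div (fbit (x % 2) (y % 2)) (bitwise-go f k (x / 2) (y / 2))) set)

bitwise-set-bit : ∀ f → BitValued f → ∀ j x y →
  bit j (bitwise f x y) ≡ 1 → f (bit j x) (bit j y) ≡ 1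
bitwise-set-bit f fbit j x y = bitwise-go-set-bit f fbit j (x + y) x y

andBit-bit-valued : BitValued andBit
andBit-bit-valued zero    b       = s≤s z≤n
andBit-bit-valued (suc a) zero    = s≤s z≤n
andBit-bit-valued (suc a) (suc b) = s≤s (s≤s z≤n)

xorBit-bit-valued : BitValued xorBit
xorBit-bit-valued zero    zero    = s≤s z≤n
xorBit-bit-valued zero    (suc b) = s≤s (s≤s z≤n)
xorBit-bit-valued (suc a) zero    = s≤s (s≤s z≤n)
xorBit-bit-valued (suc a) (suc b) = s≤s z≤n

and-xor-exclusive : ∀ a b → andBit a b ≡ 1 → xorBit a b ≡ 1 → ⊥
and-xor-exclusive zero    b       ()
and-xor-exclusive (suc a) zero    ()
and-xor-exclusive (suc a) (suc b) _ ()

cvt-xor-bits-disjoint : ∀ j X Y →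
  bit (suc j) (CVT X Y) ≡ 1 → bit j (XOR X Y) ≡ 1 → ⊥
cvt-xor-bits-disjoint j X Y cvtSet xorSet =
  and-xor-exclusive (bit j X) (bit j Y)
    (bitwise-set-bit andBit andBit-bit-valued j X Y
       (trans (sym (bit-double j (AND X Y))) cvtSet))
    (bitwise-set-bit xorBit xorBit-bit-valued j X Y xorSet)

theorem3 : (n P Q : ℕ) → P % 2 ≡ 0 → P < 2 ^ suc n → Q < 2 ^ suc n →
    (∃[ i ] (1 ≤ i × i ≤ n × bit i P ≡ 1 × bit (i ∸ 1) Q ≡ 1)) →
    (¬ (∃[ X ] ∃[ Y ] (CVT X Y ≡ P × XOR X Y ≡ Q))) × IsLeaf P Q
theorem3 n P Q _ _ _ (zero  , ()    , _)
theorem3 n P Q _ _ _ (suc j , _ , _ , pSet , qSet) = noPreimage , noPreimage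
  where
  noPreimage : ¬ (∃[ X ] ∃[ Y ] (CVT X Y ≡ P × XOR X Y ≡ Q))
  noPreimage (X , Y , refl , refl) = cvt-xor-bits-disjoint j X Y pSet qSet
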